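{- Let $m\ge2$ and $k\ge1$ be integers, and suppose $k=pk'$ for positive integers $p,k'$. Let $t$ be an $m$-ary tree on which a right $k$-rotation can be performed at some node $v$, and let $t^{\ast}$ be the resulting tree. Then $t^{\ast}$ can be obtained from $t$ by a sequence of $p$ right $k'$-rotations. The analogous statement holds for left $k$-rotations and left $k'$-rotations.
   Context: An $m$-ary tree is a rooted tree in which each node has either $0$ or $m$ linearly ordered children. For $m$-ary trees $s_1,\dots,s_m$, the meet $s_1\wedge\dots\wedge s_m$ is the tree whose root has $s_i$ as the subtree rooted at its $i$-th child. Longer meets are left-nested: $s_1\wedge\dots\wedge s_{m+h(m-1)}$ means $((\dots((s_1\wedge\dots\wedge s_m)\wedge s_{m+1}\wedge\dots\wedge s_{2m-1})\dots)\wedge\dots\wedge s_{m+h(m-1)})$. A right $k$-rotation at a node $v$ of $t$: if the subtree rooted at $v$ is $s=t_1\wedge\dots\wedge t_{j-1}\wedge(t_j\wedge t_{j+1}\wedge\dots\wedge t_{j+k(m-1)})\wedge t_{j+k(m-1)+1}\wedge\dots\wedge t_{m+k(m-1)}$ for some $1\le j\le m-1$ and $m$-ary trees $t_1,\dots,t_{m+k(m-1)}$ (possibly single nodes), replace it by $s'=t_1\wedge\dots\wedge t_{j-1}\wedge t_j\wedge(t_{j+1}\wedge\dots\wedge t_{j+k(m-1)}\wedge t_{j+k(m-1)+1})\wedge t_{j+k(m-1)+2}\wedge\dots\wedge t_{m+k(m-1)}$. A left $k$-rotation is the inverse operation (replacing $s'$ by $s$). -}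

module Defs where

open import Data.Nat using (ℕ; zero; suc; _+_; _*_; _∸_)
open import Data.Nat.Properties using (+-comm)
open import Data.Fin using (Fin)
open import Data.Vec using (Vec; []; _∷_; _++_; _∷ʳ_; cast; splitAt; lookup; _[_]≔_)
open import Data.Product using (_,_)
open import Relation.Binary.PropositionalEquality using (_≡_; cong)

data Tree (m : ℕ) : Set where
  leaf : Tree m
  node : Vec (Tree m) m → Tree m

-- t ∧ s₂ ∧ … ∧ sₘ  (root with children t, s₂, …, sₘ); only meaningful for m ≥ 1
join : ∀ {m} → Tree m → Vec (Tree m) (m ∸ 1) → Tree m
join {zero}  t _ = t
join {suc n} t v = node (t ∷ v)

private
  lmeet-eq : ∀ m k → suc (suc k * (m ∸ 1)) ≡ suc (k * (m ∸ 1)) + (m ∸ 1)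
  lmeet-eq m k = cong suc (+-comm (m ∸ 1) (k * (m ∸ 1)))

-- Left-nested meet of 1 + k(m-1) trees (= m + (k-1)(m-1) trees for k ≥ 1):
-- lmeet k (t₁ ∷ … ) = ((t₁ ∧ … ∧ tₘ) ∧ tₘ₊₁ ∧ … ∧ t₂ₘ₋₁) ∧ …
-- For k = 0 it is just the single tree t₁.
lmeet : ∀ {m} k → Vec (Tree m) (suc (k * (m ∸ 1))) → Tree m
lmeet zero (t ∷ []) = t
lmeet {m} (suc k) v with splitAt (suc (k * (m ∸ 1))) (cast (lmeet-eq m k) v)
... | xs , ys , _ = join (lmeet k xs) ys

-- Right k-rotation at the root.
-- pre = t₁ … t_{j-1} (a = j-1 trees), y = t_j, mid = t_{j+1} … t_{j+k(m-1)},
-- x = t_{j+k(m-1)+1}, post = t_{j+k(m-1)+2} … t_{m+k(m-1)} (b = m-j-1 trees).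
-- The condition a + 2 + b = m encodes 1 ≤ j ≤ m-1.
data RootRightRot {m : ℕ} (k : ℕ) : Tree m → Tree m → Set where
  rot : ∀ {a b} (eq : a + suc (suc b) ≡ m)
        (pre : Vec (Tree m) a) (y : Tree m) (mid : Vec (Tree m) (k * (m ∸ 1)))
        (x : Tree m) (post : Vec (Tree m) b) →
        RootRightRot k
          (node (cast eq (pre ++ (lmeet k (y ∷ mid) ∷ x ∷ post))))
          (node (cast eq (pre ++ (y ∷ lmeet k (mid ∷ʳ x) ∷ post))))

data RightRot {m : ℕ} (k : ℕ) : Tree m → Tree m → Set where
  here  : ∀ {s s'} → RootRightRot k s s' → RightRot k s s'
  there : ∀ (cs : Vec (Tree m) m) (i : Fin m) {u} →
          RightRot k (lookup cs i) u → RightRot k (node cs) (node (cs [ i ]≔ u))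

LeftRot : ∀ {m : ℕ} (k : ℕ) → Tree m → Tree m → Set
LeftRot k t t' = RightRot k t' t

data Steps {A : Set} (R : A → A → Set) : ℕ → A → A → Set where
  done : ∀ {x} → Steps R zero x x
  step : ∀ {n x y z} → R x y → Steps R n y z → Steps R (suc n) x z

-- A right (k₁ + k₂)-rotation, k₂ ≥ 1, factors as a right k₁-rotation followed by a right
-- k₂-rotation. Split the k₁ + k₂ levels of the left-nested meet t_j ∧ … at the root into the
-- inner k₁ levels and the outer k₂ ones, and let x′ be the first tree of the outer chunks.
-- The innermost outer node has the shape (t_j ∧ …) ∧ x′ ∧ …, where a right k₁-rotation moves
-- x′ into a k₁-meet q; what remains is a meet t_j ∧ q ∧ … with k₂ levels, and rotating it
-- by k₂ gives the same tree as the original rotation. Induction on p with k₁ = k′ gives the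
-- right case, rotations below the root are transported along the path to v, and the left
-- case is the right one read backwards.

module Submission where

open import Defs
open import Data.Nat using (ℕ; zero; suc; _+_; _*_; _∸_; _≤_; s≤s; z≤n)
open import Data.Nat.Properties using (+-comm; +-identityʳ; *-distribʳ-+)
open import Data.Fin using (zero; _↑ʳ_)
open import Data.List as List using (List; _∷_; [_])
open import Data.List.Properties using (++-assoc; ++-identityʳ; ∷-injectiveˡ; ∷-injectiveʳ)
open import Data.Product using (_×_; _,_; ∃-syntax; ∃₂)
open import Data.Vec using (Vec; []; _∷_; _++_; _∷ʳ_; toList; cast; splitAt; _[_]≔_)
open import Data.Vec.Properties
  using (toList-injective; toList-cast; toList-++; toList-∷ʳ; ++-injective;
         lookup-++ʳ; []≔-++-↑ʳ; lookup∘update; []≔-idempotent; []≔-lookup)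
open import Data.Vec.Relation.Binary.Equality.Cast using (cast-is-id)
open import Function using (flip)
open import Relation.Binary.PropositionalEquality
  using (_≡_; refl; sym; trans; cong; cong₂; subst; subst₂; module ≡-Reasoning)

open ≡-Reasoning

private variable
  A : Set
  m n : ℕ

-- Vector lengths such as (a + b) * c and a * c + b * c agree only propositionally, so
-- vectors are compared through their lists.
toList-injective′ : (xs ys : Vec A n) → toList xs ≡ toList ys → xs ≡ ys
toList-injective′ xs ys e = trans (sym (cast-is-id refl xs)) (toList-injective refl xs ys e)

toList-++-injective : (xs xs′ : Vec A n) {ys ys′ : List A} →
                      toList xs List.++ ys ≡ toList xs′ List.++ ys′ → xs ≡ xs′ × ys ≡ ys′
toList-++-injective []       []         e = refl , e
toList-++-injective (x ∷ xs) (x′ ∷ xs′) e with toList-++-injective xs xs′ (∷-injectiveʳ e)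
... | xs≡xs′ , ys≡ys′ = cong₂ _∷_ (∷-injectiveˡ e) xs≡xs′ , ys≡ys′

splitAt-cast : ∀ m {n o} → .(o ≡ m + n) → (v : Vec A o) →
               ∃₂ λ (xs : Vec A m) (ys : Vec A n) → toList v ≡ toList xs List.++ toList ys
splitAt-cast m eq v with splitAt m (cast eq v)
... | xs , ys , split≡ = xs , ys , (begin
  toList v                     ≡⟨ toList-cast eq v ⟨
  toList (cast eq v)           ≡⟨ cong toList split≡ ⟩
  toList (xs ++ ys)            ≡⟨ toList-++ xs ys ⟩
  toList xs List.++ toList ys  ∎)

Steps-snoc : ∀ {R : A → A → Set} {n x y z} → Steps R n x y → R y z → Steps R (suc n) x z
Steps-snoc done       r′ = step r′ done
Steps-snoc (step r s) r′ = step r (Steps-snoc s r′)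

Steps-reverse : ∀ {R : A → A → Set} {n x y} → Steps R n x y → Steps (flip R) n y x
Steps-reverse done       = done
Steps-reverse (step r s) = Steps-snoc (Steps-reverse s) r

Steps-map : ∀ {R S : A → A → Set} (f : A → A) → (∀ {x y} → R x y → S (f x) (f y)) →
            ∀ {n x y} → Steps R n x y → Steps S n (f x) (f y)
Steps-map f f-resp done       = done
Steps-map f f-resp (step r s) = step (f-resp r) (Steps-map f f-resp s)

lmeet-sucʳ : ∀ k (v : Vec (Tree m) (suc (suc k * (m ∸ 1)))) (xs : Vec (Tree m) (suc (k * (m ∸ 1))))
             (ys : Vec (Tree m) (m ∸ 1)) → toList v ≡ toList xs List.++ toList ys →
             lmeet (suc k) v ≡ join (lmeet k xs) ys
-- The with-term must be the one lmeet unfolds to; the length proof in cast is irrelevant,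
-- so the private one of Defs can be replaced by any other.
lmeet-sucʳ {m} k v xs ys e
  with splitAt (suc (k * (m ∸ 1))) (cast (cong suc (+-comm (m ∸ 1) (k * (m ∸ 1)))) v)
... | xs′ , ys′ , split≡ with ++-injective xs′ xs (toList-injective′ (xs′ ++ ys′) (xs ++ ys) (begin
  toList (xs′ ++ ys′)          ≡⟨ cong toList split≡ ⟨
  toList (cast _ v)            ≡⟨ toList-cast _ v ⟩
  toList v                     ≡⟨ e ⟩
  toList xs List.++ toList ys  ≡⟨ toList-++ xs ys ⟨
  toList (xs ++ ys)            ∎))
... | xs′≡xs , ys′≡ys = cong₂ (λ xs ys → join (lmeet k xs) ys) xs′≡xs ys′≡ys

lmeet-sucˡ : ∀ r (t : Tree m) (xs : Vec (Tree m) (m ∸ 1)) (ys : Vec (Tree m) (r * (m ∸ 1))) →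
             lmeet (suc r) (t ∷ xs ++ ys) ≡ lmeet r (join t xs ∷ ys)
lmeet-sucˡ zero t xs [] =
  lmeet-sucʳ zero (t ∷ xs ++ []) (t ∷ []) xs (cong (t ∷_) (trans (toList-++ xs []) (++-identityʳ _)))
lmeet-sucˡ {m} (suc r) t xs ys with splitAt-cast (r * (m ∸ 1)) (+-comm (m ∸ 1) (r * (m ∸ 1))) ys
... | ys₁ , ys₂ , ys≡ = begin
  lmeet (suc (suc r)) (t ∷ xs ++ ys)      ≡⟨ lmeet-sucʳ (suc r) _ (t ∷ xs ++ ys₁) ys₂ (cong (t ∷_) xs++ys≡) ⟩
  join (lmeet (suc r) (t ∷ xs ++ ys₁)) ys₂ ≡⟨ cong (λ s → join s ys₂) (lmeet-sucˡ r t xs ys₁) ⟩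
  join (lmeet r (join t xs ∷ ys₁)) ys₂     ≡⟨ lmeet-sucʳ r (join t xs ∷ ys) (join t xs ∷ ys₁) ys₂ (cong (_ ∷_) ys≡) ⟨
  lmeet (suc r) (join t xs ∷ ys)          ∎
  where
  xs++ys≡ : toList (xs ++ ys) ≡ toList (xs ++ ys₁) List.++ toList ys₂
  xs++ys≡ = begin
    toList (xs ++ ys)                                  ≡⟨ toList-++ xs ys ⟩
    toList xs List.++ toList ys                        ≡⟨ cong (toList xs List.++_) ys≡ ⟩
    toList xs List.++ toList ys₁ List.++ toList ys₂    ≡⟨ ++-assoc (toList xs) _ _ ⟨
    (toList xs List.++ toList ys₁) List.++ toList ys₂  ≡⟨ cong (List._++ toList ys₂) (toList-++ xs ys₁) ⟨
    toList (xs ++ ys₁) List.++ toList ys₂              ∎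

lmeet-++ : ∀ a b (v : Vec (Tree m) (suc ((a + b) * (m ∸ 1)))) (u : Vec (Tree m) (suc (a * (m ∸ 1))))
           (ys : Vec (Tree m) (b * (m ∸ 1))) → toList v ≡ toList u List.++ toList ys →
           lmeet (a + b) v ≡ lmeet b (lmeet a u ∷ ys)
lmeet-++ zero b v (t ∷ []) ys e = cong (lmeet b) (toList-injective′ v (t ∷ ys) e)
lmeet-++ {m} (suc a) b (t ∷ v) (t′ ∷ u) ys e with splitAt (m ∸ 1) v | splitAt (m ∸ 1) u
... | xs , v′ , refl | xs′ , u′ , refl with toList-++-injective xs xs′ (begin
  toList xs List.++ toList v′                          ≡⟨ toList-++ xs v′ ⟨
  toList (xs ++ v′)                                    ≡⟨ ∷-injectiveʳ e ⟩
  toList (xs′ ++ u′) List.++ toList ys                 ≡⟨ cong (List._++ toList ys) (toList-++ xs′ u′) ⟩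
  (toList xs′ List.++ toList u′) List.++ toList ys     ≡⟨ ++-assoc (toList xs′) _ _ ⟩
  toList xs′ List.++ toList u′ List.++ toList ys       ∎)
... | xs≡xs′ , v′≡u′++ys = begin
  lmeet (suc (a + b)) (t ∷ xs ++ v′)         ≡⟨ lmeet-sucˡ (a + b) t xs v′ ⟩
  lmeet (a + b) (join t xs ∷ v′)             ≡⟨ lmeet-++ a b _ (join t′ xs′ ∷ u′) ys
                                                  (cong₂ _∷_ (cong₂ join (∷-injectiveˡ e) xs≡xs′) v′≡u′++ys) ⟩
  lmeet b (lmeet a (join t′ xs′ ∷ u′) ∷ ys)  ≡⟨ cong (λ s → lmeet b (s ∷ ys)) (lmeet-sucˡ a t′ xs′ u′) ⟨
  lmeet b (lmeet (suc a) (t′ ∷ xs′ ++ u′) ∷ ys) ∎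

rot′ : ∀ {a b} k (pre : Vec (Tree (a + suc (suc b))) a) y mid x (post : Vec _ b) →
       RootRightRot k (node (pre ++ lmeet k (y ∷ mid) ∷ x ∷ post)) (node (pre ++ y ∷ lmeet k (mid ∷ʳ x) ∷ post))
rot′ k pre y mid x post =
  subst₂ (λ cs cs′ → RootRightRot k (node cs) (node cs′)) (cast-is-id refl _) (cast-is-id refl _)
    (rot refl pre y mid x post)

RightRot-update : ∀ {k} (cs : Vec (Tree m) m) i {u u′} → RightRot k u u′ →
                  RightRot k (node (cs [ i ]≔ u)) (node (cs [ i ]≔ u′))
RightRot-update {k = k} cs i {u} {u′} r =
  subst (λ cs′ → RightRot k (node (cs [ i ]≔ u)) (node cs′)) ([]≔-idempotent cs i)
    (there (cs [ i ]≔ u) i (subst (λ s → RightRot k s u′) (sym (lookup∘update i cs u)) r))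

RightRot-child : ∀ {k a b} (eq : a + suc b ≡ m) (pre : Vec (Tree m) a) (post : Vec (Tree m) b) {u u′} →
                 RightRot k u u′ → RightRot k (node (cast eq (pre ++ u ∷ post))) (node (cast eq (pre ++ u′ ∷ post)))
RightRot-child {k = k} {a} refl pre post {u} {u′} r =
  subst₂ (λ cs cs′ → RightRot k (node cs) (node cs′)) (sym (cast-is-id refl _)) (sym (cast-is-id refl _))
    (subst (λ cs → RightRot k (node (pre ++ u ∷ post)) (node cs)) ([]≔-++-↑ʳ pre (u ∷ post) zero)
      (there (pre ++ u ∷ post) (a ↑ʳ zero) (subst (λ s → RightRot k s u′) (sym (lookup-++ʳ pre (u ∷ post) zero)) r)))

RightRot-lmeetˡ : ∀ {k} r (ys : Vec (Tree (suc m)) (r * m)) {u u′} →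
                  RightRot k u u′ → RightRot k (lmeet r (u ∷ ys)) (lmeet r (u′ ∷ ys))
RightRot-lmeetˡ zero [] r = r
RightRot-lmeetˡ {m} {k} (suc r) ys {u} {u′} rot-u with splitAt-cast (r * m) (+-comm m (r * m)) ys
... | ys₁ , ys₂ , ys≡ =
  subst₂ (RightRot k) (sym (lmeet-sucʳ r (u ∷ ys) (u ∷ ys₁) ys₂ (cong (u ∷_) ys≡)))
                      (sym (lmeet-sucʳ r (u′ ∷ ys) (u′ ∷ ys₁) ys₂ (cong (u′ ∷_) ys≡)))
    (there (lmeet r (u ∷ ys₁) ∷ ys₂) zero (RightRot-lmeetˡ r ys₁ rot-u))

rootRightRot-split : ∀ k r {s s″ : Tree (suc (suc n))} → RootRightRot (k + suc r) s s″ →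
                     ∃[ s′ ] RightRot k s s′ × RootRightRot (suc r) s′ s″
rootRightRot-split {n} k r (rot eq pre y mid x post)
  with splitAt-cast (k * suc n) (*-distribʳ-+ (suc n) k (suc r)) mid
... | mid₁ , x′ ∷ rest , mid≡ with splitAt n rest
... | post′ , mid₂ , refl = _ , first , subst (RootRightRot (suc r) _) rest-rotated (rot eq pre y (q ∷ post′ ++ mid₂) x post)
  where
  q : Tree (suc (suc n))
  q = lmeet k (mid₁ ∷ʳ x′)

  inner : lmeet (k + suc r) (y ∷ mid) ≡ lmeet r (node (lmeet k (y ∷ mid₁) ∷ x′ ∷ post′) ∷ mid₂)
  inner = trans (lmeet-++ k (suc r) (y ∷ mid) (y ∷ mid₁) (x′ ∷ post′ ++ mid₂) (cong (y ∷_) mid≡))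
                (lmeet-sucˡ r (lmeet k (y ∷ mid₁)) (x′ ∷ post′) mid₂)

  first : RightRot k (node (cast eq (pre ++ lmeet (k + suc r) (y ∷ mid) ∷ x ∷ post)))
                     (node (cast eq (pre ++ lmeet (suc r) (y ∷ q ∷ post′ ++ mid₂) ∷ x ∷ post)))
  first = RightRot-child eq pre (x ∷ post)
            (subst₂ (RightRot k) (sym inner) (sym (lmeet-sucˡ r y (q ∷ post′) mid₂))
              (RightRot-lmeetˡ r mid₂ (here (rot′ k [] y mid₁ x′ post′))))

  mid∷ʳx≡ : toList (mid ∷ʳ x) ≡ toList (mid₁ ∷ʳ x′) List.++ toList ((post′ ++ mid₂) ∷ʳ x)
  mid∷ʳx≡ = begin
    toList (mid ∷ʳ x)                                                   ≡⟨ toList-∷ʳ x mid ⟩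
    toList mid List.++ [ x ]                                            ≡⟨ cong (List._++ [ x ]) mid≡ ⟩
    (toList mid₁ List.++ x′ ∷ toList (post′ ++ mid₂)) List.++ [ x ]      ≡⟨ ++-assoc (toList mid₁) _ _ ⟩
    toList mid₁ List.++ x′ ∷ toList (post′ ++ mid₂) List.++ [ x ]        ≡⟨ cong (λ l → toList mid₁ List.++ x′ ∷ l)
                                                                             (toList-∷ʳ x (post′ ++ mid₂)) ⟨
    toList mid₁ List.++ [ x′ ] List.++ toList ((post′ ++ mid₂) ∷ʳ x)     ≡⟨ ++-assoc (toList mid₁) _ _ ⟨
    (toList mid₁ List.++ [ x′ ]) List.++ toList ((post′ ++ mid₂) ∷ʳ x)   ≡⟨ cong (List._++ _) (toList-∷ʳ x′ mid₁) ⟨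
    toList (mid₁ ∷ʳ x′) List.++ toList ((post′ ++ mid₂) ∷ʳ x)            ∎

  rest-rotated : node (cast eq (pre ++ y ∷ lmeet (suc r) (q ∷ ((post′ ++ mid₂) ∷ʳ x)) ∷ post))
               ≡ node (cast eq (pre ++ y ∷ lmeet (k + suc r) (mid ∷ʳ x) ∷ post))
  rest-rotated = cong (λ s → node (cast eq (pre ++ y ∷ s ∷ post)))
                   (sym (lmeet-++ k (suc r) (mid ∷ʳ x) (mid₁ ∷ʳ x′) ((post′ ++ mid₂) ∷ʳ x) mid∷ʳx≡))

rootRightRot-steps : ∀ q k {s s′ : Tree (suc (suc n))} →
                     RootRightRot (suc q * suc k) s s′ → Steps (RightRot (suc k)) (suc q) s s′
rootRightRot-steps zero k {s} {s′} r = step (here (subst (λ k′ → RootRightRot k′ s s′) (+-identityʳ (suc k)) r)) done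
rootRightRot-steps (suc q) k r with rootRightRot-split (suc k) (k + q * suc k) r
... | _ , first , rest = step first (rootRightRot-steps q k rest)

rightRot-steps : ∀ q k {t t* : Tree (suc (suc n))} →
                 RightRot (suc q * suc k) t t* → Steps (RightRot (suc k)) (suc q) t t*
rightRot-steps q k (here r) = rootRightRot-steps q k r
rightRot-steps q k (there cs i {u} r) =
  subst (λ cs′ → Steps (RightRot (suc k)) (suc q) (node cs′) (node (cs [ i ]≔ u))) ([]≔-lookup cs i)
    (Steps-map (λ u → node (cs [ i ]≔ u)) (RightRot-update cs i) (rightRot-steps q k r))

proposition2p10 : (m k p k' : ℕ) → 2 ≤ m → 1 ≤ k → 1 ≤ p → 1 ≤ k' → k ≡ p * k' →
    ((t t* : Tree m) → RightRot k t t* → Steps (RightRot k') p t t*)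
    × ((t t* : Tree m) → LeftRot k t t* → Steps (LeftRot k') p t t*)
proposition2p10 (suc (suc n)) _ (suc q) (suc k) (s≤s (s≤s z≤n)) _ (s≤s z≤n) (s≤s z≤n) refl =
  (λ _ _ → rightRot-steps q k) , (λ _ _ r → Steps-reverse (rightRot-steps q k r))
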